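{- Let $P$ be a poset with $k$ points that is not an antichain, and let $m>1$ be an integer. Then $$e(m,P)<\left(\tfrac34\right)^m(2^m-1)^k=\left(\tfrac34\right)^m e(m,A_k),$$ where $A_k$ is the $k$-element antichain.
   Context: For a finite poset $P$ on $K$ and a finite set $M$ disjoint from $K$ with $|M|=m$, $e(m,P)$ is the number of partial orders on $M\cup K$ inducing $P$ on $K$ whose set of minimal elements is exactly $M$. -}

module Defs where

open import Data.Nat using (ℕ; zero; suc; _+_)
open import Data.Bool using (Bool; true; false)
open import Data.Fin using (Fin; zero; suc; _↑ˡ_; _↑ʳ_)
open import Data.Fin.Properties using (all?; any?) renaming (_≟_ to _≟ᶠ_)
open import Data.Bool.Properties renaming (_≟_ to _≟ᵇ_)
open import Data.List using (List; []; _∷_; concatMap; map; filter; length)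
open import Data.Product using (Σ; _×_; _,_; ∃)
open import Relation.Nullary using (Dec; yes; no; ¬_)
open import Relation.Nullary.Decidable using (_×-dec_; _→-dec_)
open import Relation.Binary.PropositionalEquality using (_≡_; _≢_)

Rel : ℕ → Set
Rel n = Fin n → Fin n → Bool

IsPartialOrder : ∀ {n} → Rel n → Set
IsPartialOrder {n} R =
  (∀ x → R x x ≡ true) ×
  (∀ x y → R x y ≡ true → R y x ≡ true → x ≡ y) ×
  (∀ x y z → R x y ≡ true → R y z ≡ true → R x z ≡ true)

record FinPoset (k : ℕ) : Set where
  field
    rel     : Rel k
    isPO    : IsPartialOrder rel

open FinPoset public

antichain : (k : ℕ) → FinPoset k
antichain k = record
  { rel  = λ x y → isYes (x ≟ᶠ y)
  ; isPO = refl' , antisym' , trans' }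
  where
  open import Relation.Nullary.Decidable using (isYes)
  open import Relation.Binary.PropositionalEquality using (refl; trans)
  refl' : ∀ x → isYes (x ≟ᶠ x) ≡ true
  refl' x with x ≟ᶠ x
  ... | yes _ = refl
  ... | no ¬p = Data.Empty.⊥-elim (¬p refl)
    where import Data.Empty
  eqOf : ∀ x y → isYes (x ≟ᶠ y) ≡ true → x ≡ y
  eqOf x y h with x ≟ᶠ y
  ... | yes p = p
  eqOf x y () | no _
  antisym' : ∀ x y → isYes (x ≟ᶠ y) ≡ true → isYes (y ≟ᶠ x) ≡ true → x ≡ y
  antisym' x y h _ = eqOf x y h
  trans' : ∀ x y z → isYes (x ≟ᶠ y) ≡ true → isYes (y ≟ᶠ z) ≡ true → isYes (x ≟ᶠ z) ≡ true
  trans' x y z h1 h2 with eqOf x y h1 | eqOf y z h2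
  ... | refl | refl = h1

IsAntichain : ∀ {k} → FinPoset k → Set
IsAntichain {k} P = ∀ (i j : Fin k) → rel P i j ≡ true → i ≡ j

-- Ground set M ∪ K is modelled as Fin (m + k): M = (Fin m) ↑ˡ k,
-- K = m ↑ʳ (Fin k).
Minimal : ∀ {n} → Rel n → Fin n → Set
Minimal R x = ∀ y → R y x ≡ true → y ≡ x

IsExtension : (m : ℕ) → ∀ {k} → FinPoset k → Rel (m + k) → Set
IsExtension m {k} P Q =
  IsPartialOrder Q ×
  (∀ (i j : Fin k) → Q (m ↑ʳ i) (m ↑ʳ j) ≡ rel P i j) ×
  (∀ (i : Fin m) → Minimal Q (i ↑ˡ k)) ×
  (∀ (j : Fin k) → ¬ Minimal Q (m ↑ʳ j))

isExtension? : (m : ℕ) → ∀ {k} → (P : FinPoset k) → (Q : Rel (m + k)) → Dec (IsExtension m P Q)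
isExtension? m {k} P Q =
  ((all? λ x → Q x x ≟ᵇ true) ×-dec
   (all? λ x → all? λ y → (Q x y ≟ᵇ true) →-dec ((Q y x ≟ᵇ true) →-dec (x ≟ᶠ y))) ×-dec
   (all? λ x → all? λ y → all? λ z → (Q x y ≟ᵇ true) →-dec ((Q y z ≟ᵇ true) →-dec (Q x z ≟ᵇ true))))
  ×-dec (all? λ i → all? λ j → Q (m ↑ʳ i) (m ↑ʳ j) ≟ᵇ rel P i j)
  ×-dec (all? λ i → min? (i ↑ˡ k))
  ×-dec (all? λ j → ¬? (min? (m ↑ʳ j)))
  where
  open import Relation.Nullary.Decidable using (¬?)
  min? : ∀ x → Dec (Minimal Q x)
  min? x = all? λ y → (Q y x ≟ᵇ true) →-dec (y ≟ᶠ x)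

allFuns : ∀ {A : Set} → List A → (n : ℕ) → List (Fin n → A)
allFuns as zero = (λ ()) ∷ []
allFuns as (suc n) =
  concatMap (λ a → map (λ f → λ { zero → a ; (suc i) → f i }) (allFuns as n)) as

allRels : (n : ℕ) → List (Rel n)
allRels n = allFuns (allFuns (false ∷ true ∷ []) n) n

e : (m : ℕ) → ∀ {k} → FinPoset k → ℕ
e m {k} P = length (filter (isExtension? m P) (allRels (m + k)))

-- A partial order on M ∪ K inducing P on K whose minimal elements are exactly M is determined
-- by which new points i ∈ M lie below which old points j ∈ K: M is an antichain, nothing of K
-- lies below M, and the data define an extension exactly when the set of new points below j is
-- nonempty and grows along P. Hence e(m,P) counts the order-preserving maps from P to the
-- nonempty subsets of M, giving (2^m − 1)^k for the antichain. If a < b in P, the values at a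
-- and b form a pair x ⊆ y with x nonempty, of which there are 3^m − 2^m, so
-- e(m,P) ≤ (3^m − 2^m)(2^m − 1)^(k−2); and 4^m (3^m − 2^m) < 3^m (2^m − 1)^2 rearranges to
-- 2·6^m < 8^m + 3^m, which holds for m ≥ 2.

module Submission where

open import Defs
open import Data.Nat using (ℕ; zero; suc; _+_; _*_; _^_; _∸_; _≤_; _<_; z≤n; s≤s; NonZero; >-nonZero)
open import Data.Nat.Properties hiding (suc-injective; _≟_)
open import Data.Nat.Tactic.RingSolver using (solve-∀)
open import Data.Fin using (Fin; zero; suc; _↑ˡ_; _↑ʳ_; punchIn; punchOut; splitAt)
open import Data.Bool using (Bool; true; false; _∧_; _∨_; not)
open import Data.List using (List; []; _∷_; _++_; map; concatMap; filter; length)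
open import Data.Vec.Functional as V using (Vector; insertAt; zipWith; transpose)
  renaming (_∷_ to _∷ᵥ_; [] to []ᵥ; _++_ to _++ᵥ_)
open import Data.Sum using (inj₁; inj₂)
open import Data.Product using (Σ; _×_; _,_; proj₁; proj₂)
open import Data.Empty using (⊥; ⊥-elim)
open import Data.Fin.Properties using (all?; ¬∀⟶∃¬; ↑ˡ-injective; suc-injective; punchIn-punchOut) renaming (_≟_ to _≟ᶠ_)
open import Data.Bool.Properties using () renaming (_≟_ to _≟ᵇ_)
open import Data.Nat.Induction using (<-wellFounded)
open import Induction.WellFounded using (Acc; acc)
import Relation.Binary.Construct.On as On
open import Function.Base using (_on_)
open import Level using (0ℓ)
open import Relation.Binary.Bundles using (Setoid)
open import Relation.Binary.Core using (_Preserves_⟶_)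
open import Relation.Nullary using (¬_; Dec; yes; no)
open import Relation.Nullary.Decidable using (isYes; _→-dec_)
open import Relation.Binary.PropositionalEquality hiding ([_])
open import Algebra.Properties.CommutativeSemigroup +-commutativeSemigroup using (interchange)
import Data.Vec.Functional.Relation.Binary.Equality.Setoid as VectorSetoid
open import Data.Vec.Functional.Relation.Binary.Pointwise.Properties using (++⁺)
open import Data.Vec.Functional.Properties using (lookup-++ˡ; lookup-++ʳ; insertAt-lookup; insertAt-punchIn)

-- Finite sums

[_] : Bool → ℕ
[ true ] = 1
[ false ] = 0

Summation : Set → Set
Summation A = (A → ℕ) → ℕ

record IsSummation {A : Set} (∑ : Summation A) : Set where
  field
    ∑-cong      : ∀ {f g : A → ℕ} → (∀ a → f a ≡ g a) → ∑ f ≡ ∑ g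
    ∑-distrib-+ : ∀ (f g : A → ℕ) → ∑ (λ a → f a + g a) ≡ ∑ f + ∑ g
    ∑-zero      : ∑ (λ _ → 0) ≡ 0
    ∑-mono-≤    : ∀ {f g : A → ℕ} → (∀ a → f a ≤ g a) → ∑ f ≤ ∑ g

open IsSummation public

module _ {A : Set} {∑ : Summation A} (isSum : IsSummation ∑) where

  ∑-*ˡ : ∀ c (f : A → ℕ) → ∑ (λ a → c * f a) ≡ c * ∑ f
  ∑-*ˡ zero    f = ∑-zero isSum
  ∑-*ˡ (suc c) f = trans (∑-distrib-+ isSum f (λ a → c * f a)) (cong (∑ f +_) (∑-*ˡ c f))

  ∑-*ʳ : ∀ c (f : A → ℕ) → ∑ (λ a → f a * c) ≡ ∑ f * c
  ∑-*ʳ c f = trans (∑-cong isSum (λ a → *-comm (f a) c)) (trans (∑-*ˡ c f) (*-comm c (∑ f)))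

  ∑-*ʳ-≡1 : ∀ {w : A → ℕ} → ∑ w ≡ 1 → ∀ c → ∑ (λ a → w a * c) ≡ c
  ∑-*ʳ-≡1 {w} ∑w≡1 c = trans (∑-*ʳ c w) (trans (cong (_* c) ∑w≡1) (*-identityˡ c))

Commute : ∀ {A B : Set} → Summation A → Summation B → Set
Commute {A} {B} ∑ ∑′ = ∀ (f : A → B → ℕ) → ∑ (λ a → ∑′ (f a)) ≡ ∑′ (λ b → ∑ (λ a → f a b))

commute-sym : ∀ {A B : Set} {∑ : Summation A} {∑′ : Summation B} → Commute ∑ ∑′ → Commute ∑′ ∑
commute-sym comm f = sym (comm (λ a b → f b a))

sumList : ∀ {A : Set} → List A → Summation A
sumList []       f = 0
sumList (x ∷ xs) f = f x + sumList xs f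

isSummation-sumList : ∀ {A : Set} (xs : List A) → IsSummation (sumList xs)
isSummation-sumList {A} xs = record
  { ∑-cong = congruent xs ; ∑-distrib-+ = distrib xs ; ∑-zero = zeroes xs ; ∑-mono-≤ = mono xs }
  where
  congruent : ∀ xs {f g : A → ℕ} → (∀ a → f a ≡ g a) → sumList xs f ≡ sumList xs g
  congruent []       f≗g = refl
  congruent (x ∷ xs) f≗g = cong₂ _+_ (f≗g x) (congruent xs f≗g)
  distrib : ∀ xs (f g : A → ℕ) → sumList xs (λ a → f a + g a) ≡ sumList xs f + sumList xs g
  distrib []       f g = refl
  distrib (x ∷ xs) f g = trans (cong (f x + g x +_) (distrib xs f g)) (interchange (f x) (g x) _ _)
  zeroes : ∀ xs → sumList xs (λ _ → 0) ≡ 0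
  zeroes []       = refl
  zeroes (x ∷ xs) = zeroes xs
  mono : ∀ xs {f g : A → ℕ} → (∀ a → f a ≤ g a) → sumList xs f ≤ sumList xs g
  mono []       f≤g = z≤n
  mono (x ∷ xs) f≤g = +-mono-≤ (f≤g x) (mono xs f≤g)

sumList-commute : ∀ {A B : Set} (xs : List A) {∑ : Summation B} → IsSummation ∑ → Commute (sumList xs) ∑
sumList-commute []       isSum f = sym (∑-zero isSum)
sumList-commute (x ∷ xs) {∑} isSum f =
  trans (cong (∑ (f x) +_) (sumList-commute xs isSum f)) (sym (∑-distrib-+ isSum (f x) _))

sumList-++ : ∀ {A : Set} (xs ys : List A) (f : A → ℕ) → sumList (xs ++ ys) f ≡ sumList xs f + sumList ys f
sumList-++ []       ys f = refl
sumList-++ (x ∷ xs) ys f = trans (cong (f x +_) (sumList-++ xs ys f)) (sym (+-assoc (f x) _ _))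

sumList-map : ∀ {A B : Set} (g : A → B) (xs : List A) (f : B → ℕ) → sumList (map g xs) f ≡ sumList xs (λ a → f (g a))
sumList-map g []       f = refl
sumList-map g (x ∷ xs) f = cong (f (g x) +_) (sumList-map g xs f)

sumList-concatMap : ∀ {A B : Set} (g : A → List B) (xs : List A) (f : B → ℕ) →
  sumList (concatMap g xs) f ≡ sumList xs (λ a → sumList (g a) f)
sumList-concatMap g []       f = refl
sumList-concatMap g (x ∷ xs) f = trans (sumList-++ (g x) _ f) (cong (sumList (g x) f +_) (sumList-concatMap g xs f))

length-filter≡sumList : ∀ {A : Set} {p} {Pr : A → Set p} (Pr? : (x : A) → Dec (Pr x)) (xs : List A) →
  length (filter Pr? xs) ≡ sumList xs (λ x → [ isYes (Pr? x) ])
length-filter≡sumList Pr? [] = refl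
length-filter≡sumList Pr? (x ∷ xs) with Pr? x
... | yes _ = cong suc (length-filter≡sumList Pr? xs)
... | no  _ = length-filter≡sumList Pr? xs

-- Sums over vectors

sumVector : ∀ {A : Set} → Summation A → (n : ℕ) → Summation (Vector A n)
sumVector ∑ zero    f = f []ᵥ
sumVector ∑ (suc n) f = ∑ (λ a → sumVector ∑ n (λ v → f (a ∷ᵥ v)))

module _ {A : Set} {∑ : Summation A} (isSum : IsSummation ∑) where

  isSummation-sumVector : ∀ n → IsSummation (sumVector ∑ n)
  isSummation-sumVector n = record
    { ∑-cong = congruent n ; ∑-distrib-+ = distrib n ; ∑-zero = zeroes n ; ∑-mono-≤ = mono n }
    where
    congruent : ∀ n {f g : Vector A n → ℕ} → (∀ v → f v ≡ g v) → sumVector ∑ n f ≡ sumVector ∑ n g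
    congruent zero    f≗g = f≗g []ᵥ
    congruent (suc n) f≗g = ∑-cong isSum (λ a → congruent n (λ v → f≗g (a ∷ᵥ v)))
    distrib : ∀ n (f g : Vector A n → ℕ) → sumVector ∑ n (λ v → f v + g v) ≡ sumVector ∑ n f + sumVector ∑ n g
    distrib zero    f g = refl
    distrib (suc n) f g = trans (∑-cong isSum (λ a → distrib n _ _)) (∑-distrib-+ isSum _ _)
    zeroes : ∀ n → sumVector ∑ n (λ _ → 0) ≡ 0
    zeroes zero    = refl
    zeroes (suc n) = trans (∑-cong isSum (λ a → zeroes n)) (∑-zero isSum)
    mono : ∀ n {f g : Vector A n → ℕ} → (∀ v → f v ≤ g v) → sumVector ∑ n f ≤ sumVector ∑ n g
    mono zero    f≤g = f≤g []ᵥ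
    mono (suc n) f≤g = ∑-mono-≤ isSum (λ a → mono n (λ v → f≤g (a ∷ᵥ v)))

  sumVector-commute : ∀ {B : Set} {∑′ : Summation B} → Commute ∑ ∑′ → ∀ n → Commute (sumVector ∑ n) ∑′
  sumVector-commute comm zero    f = refl
  sumVector-commute {∑′ = ∑′} comm (suc n) f =
    trans (∑-cong isSum (λ a → sumVector-commute {∑′ = ∑′} comm n (λ v → f (a ∷ᵥ v))))
          (comm (λ a b → sumVector ∑ n (λ v → f (a ∷ᵥ v) b)))

-- Vectors are functions, so without function extensionality sums over vectors can only be
-- rearranged for summands that respect pointwise equality.
Extensional : (X : Setoid 0ℓ 0ℓ) → (Setoid.Carrier X → ℕ) → Set
Extensional X f = f Preserves Setoid._≈_ X ⟶ _≡_

VecSetoid : Setoid 0ℓ 0ℓ → ℕ → Setoid 0ℓ 0ℓ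
VecSetoid = VectorSetoid.≋-setoid

module _ {X : Setoid 0ℓ 0ℓ} where

  open Setoid X using (Carrier; _≈_) renaming (refl to ≈-refl)

  extensional-∷ : ∀ {n} {f : Vector Carrier (suc n) → ℕ} → Extensional (VecSetoid X (suc n)) f →
    ∀ a → Extensional (VecSetoid X n) (λ v → f (a ∷ᵥ v))
  extensional-∷ ext a v≋w = ext λ { zero → ≈-refl ; (suc i) → v≋w i }

  extensional-sumVector-∷ : ∀ {∑ : Summation Carrier} → IsSummation ∑ → ∀ {n} {f : Vector Carrier (suc n) → ℕ} →
    Extensional (VecSetoid X (suc n)) f → Extensional X (λ a → sumVector ∑ n (λ v → f (a ∷ᵥ v)))
  extensional-sumVector-∷ isSum {n} ext a≈b =
    ∑-cong (isSummation-sumVector isSum n) (λ v → ext λ { zero → a≈b ; (suc i) → ≈-refl })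

  insertAt-cong : ∀ {n} {v w : Vector Carrier n} → (∀ i → v i ≈ w i) →
    ∀ p c i → insertAt v p c i ≈ insertAt w p c i
  insertAt-cong         v≋w zero    c zero    = ≈-refl
  insertAt-cong         v≋w zero    c (suc i) = v≋w i
  insertAt-cong {suc n} v≋w (suc p) c zero    = v≋w zero
  insertAt-cong {suc n} v≋w (suc p) c (suc i) = insertAt-cong (λ i → v≋w (suc i)) p c i

  sumList-allFuns : ∀ (xs : List Carrier) n {f : Vector Carrier n → ℕ} → Extensional (VecSetoid X n) f →
    sumList (allFuns xs n) f ≡ sumVector (sumList xs) n f
  sumList-allFuns xs zero    ext = trans (+-identityʳ _) (ext (λ ()))
  sumList-allFuns xs (suc n) {f} ext =
    trans (sumList-concatMap _ xs f) (∑-cong (isSummation-sumList xs) λ a → begin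
      sumList (map _ (allFuns xs n)) f          ≡⟨ sumList-map _ (allFuns xs n) f ⟩
      sumList (allFuns xs n) _                  ≡⟨ sumList-allFuns xs n (λ v≋w → ext λ { zero → ≈-refl ; (suc i) → v≋w i }) ⟩
      sumVector (sumList xs) n _                ≡⟨ ∑-cong (isSummation-sumVector (isSummation-sumList xs) n)
                                                     (λ v → ext λ { zero → ≈-refl ; (suc i) → ≈-refl }) ⟩
      sumVector (sumList xs) n (λ v → f (a ∷ᵥ v)) ∎)
    where open ≡-Reasoning

∷-++ : ∀ {A : Set} {m n} (a : A) (g : Vector A m) (h : Vector A n) → ((a ∷ᵥ g) ++ᵥ h) ≗ (a ∷ᵥ (g ++ᵥ h))
∷-++ {m = m} a g h zero    = refl
∷-++ {m = m} a g h (suc i) with splitAt m i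
... | inj₁ _ = refl
... | inj₂ _ = refl

module _ {X : Setoid 0ℓ 0ℓ} {∑ : Summation (Setoid.Carrier X)} (isSum : IsSummation ∑) where

  open Setoid X using (Carrier; _≈_; reflexive) renaming (refl to ≈-refl)

  sumVector-++ : ∀ m n {f : Vector Carrier (m + n) → ℕ} → Extensional (VecSetoid X (m + n)) f →
    sumVector ∑ (m + n) f ≡ sumVector ∑ m (λ g → sumVector ∑ n (λ h → f (g ++ᵥ h)))
  sumVector-++ zero    n ext = refl
  sumVector-++ (suc m) n {f} ext = ∑-cong isSum λ a →
    trans (sumVector-++ m n (extensional-∷ {X} {f = f} ext a))
          (∑-cong (isSummation-sumVector isSum m) λ g → ∑-cong (isSummation-sumVector isSum n) λ h →
            ext (λ i → reflexive (sym (∷-++ a g h i))))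

  sumVector-zipWith : ∀ {A B : Set} {∑ᴬ : Summation A} {∑ᴮ : Summation B} (c : A → B → Carrier) →
    IsSummation ∑ᴬ → IsSummation ∑ᴮ → Commute ∑ᴬ ∑ᴮ →
    (∀ {f} → Extensional X f → ∑ f ≡ ∑ᴬ (λ a → ∑ᴮ (λ b → f (c a b)))) →
    ∀ n {f : Vector Carrier n → ℕ} → Extensional (VecSetoid X n) f →
    sumVector ∑ n f ≡ sumVector ∑ᴬ n (λ u → sumVector ∑ᴮ n (λ v → f (zipWith c u v)))
  sumVector-zipWith c isSumᴬ isSumᴮ comm split zero    ext = ext (λ ())
  sumVector-zipWith {∑ᴬ = ∑ᴬ} {∑ᴮ} c isSumᴬ isSumᴮ comm split (suc n) {f} ext = begin
    ∑ (λ x → sumVector ∑ n (λ w → f (x ∷ᵥ w)))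
      ≡⟨ split (extensional-sumVector-∷ {X} isSum {f = f} ext) ⟩
    ∑ᴬ (λ a → ∑ᴮ (λ b → sumVector ∑ n (λ w → f (c a b ∷ᵥ w))))
      ≡⟨ ∑-cong isSumᴬ (λ a → ∑-cong isSumᴮ (λ b →
           sumVector-zipWith c isSumᴬ isSumᴮ comm split n (extensional-∷ {X} {f = f} ext (c a b)))) ⟩
    ∑ᴬ (λ a → ∑ᴮ (λ b → sumVector ∑ᴬ n (λ u → sumVector ∑ᴮ n (λ v → f (c a b ∷ᵥ zipWith c u v)))))
      ≡⟨ ∑-cong isSumᴬ (λ a → sym (sumVector-commute isSumᴬ {∑′ = ∑ᴮ} comm n _)) ⟩
    ∑ᴬ (λ a → sumVector ∑ᴬ n (λ u → ∑ᴮ (λ b → sumVector ∑ᴮ n (λ v → f (c a b ∷ᵥ zipWith c u v)))))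
      ≡⟨ ∑-cong isSumᴬ (λ a → ∑-cong (isSummation-sumVector isSumᴬ n) (λ u → ∑-cong isSumᴮ (λ b →
           ∑-cong (isSummation-sumVector isSumᴮ n) (λ v → ext λ { zero → ≈-refl ; (suc i) → ≈-refl })))) ⟩
    sumVector ∑ᴬ (suc n) (λ u → sumVector ∑ᴮ (suc n) (λ v → f (zipWith c u v))) ∎
    where open ≡-Reasoning

  sumVector-cong-∑ : ∀ {∑′ : Summation Carrier} → IsSummation ∑′ → (∀ {g} → Extensional X g → ∑ g ≡ ∑′ g) →
    ∀ n {f : Vector Carrier n → ℕ} → Extensional (VecSetoid X n) f → sumVector ∑ n f ≡ sumVector ∑′ n f
  sumVector-cong-∑ isSum′ ∑≗∑′ zero    ext = refl
  sumVector-cong-∑ isSum′ ∑≗∑′ (suc n) {f} ext =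
    trans (∑-cong isSum (λ a → sumVector-cong-∑ isSum′ ∑≗∑′ n (extensional-∷ {X} {f = f} ext a)))
          (∑≗∑′ (extensional-sumVector-∷ {X} isSum′ {f = f} ext))

  sumVector-insertAt : Commute ∑ ∑ → ∀ n (p : Fin (suc n)) {f : Vector Carrier (suc n) → ℕ} →
    Extensional (VecSetoid X (suc n)) f → sumVector ∑ (suc n) f ≡ ∑ (λ c → sumVector ∑ n (λ v → f (insertAt v p c)))
  sumVector-insertAt comm n zero ext =
    ∑-cong isSum (λ c → ∑-cong (isSummation-sumVector isSum n) (λ v → ext λ { zero → ≈-refl ; (suc i) → ≈-refl }))
  sumVector-insertAt comm (suc n) (suc p) {f} ext =
    trans (∑-cong isSum (λ a → sumVector-insertAt comm n p (extensional-∷ {X} {f = f} ext a)))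
    (trans (comm (λ a c → sumVector ∑ n (λ v → f (a ∷ᵥ insertAt v p c))))
           (∑-cong isSum (λ c → ∑-cong isSum (λ a → ∑-cong (isSummation-sumVector isSum n) (λ v →
             ext λ { zero → ≈-refl ; (suc i) → ≈-refl })))))

∏ : ∀ {n} → Vector ℕ n → ℕ
∏ = V.foldr _*_ 1

∏-cong : ∀ {n} {v w : Vector ℕ n} → (∀ i → v i ≡ w i) → ∏ v ≡ ∏ w
∏-cong {zero}  v≗w = refl
∏-cong {suc n} v≗w = cong₂ _*_ (v≗w zero) (∏-cong (λ i → v≗w (suc i)))

∏-const : ∀ n c → ∏ {n} (λ _ → c) ≡ c ^ n
∏-const zero    c = refl
∏-const (suc n) c = cong (c *_) (∏-const n c)

∏-ones : ∀ {n} {v : Vector ℕ n} → (∀ i → v i ≡ 1) → ∏ v ≡ 1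
∏-ones {n} v≡1 = trans (∏-cong v≡1) (trans (∏-const n 1) (^-zeroˡ n))

sumVector-∏ : ∀ {A : Set} {∑ : Summation A} → IsSummation ∑ → ∀ n (w : Fin n → A → ℕ) →
  sumVector ∑ n (λ v → ∏ (λ i → w i (v i))) ≡ ∏ (λ i → ∑ (w i))
sumVector-∏ isSum zero    w = refl
sumVector-∏ {∑ = ∑} isSum (suc n) w = begin
  ∑ (λ a → sumVector ∑ n (λ v → w zero a * ∏ (λ i → w (suc i) (v i))))
    ≡⟨ ∑-cong isSum (λ a → ∑-*ˡ (isSummation-sumVector isSum n) (w zero a) _) ⟩
  ∑ (λ a → w zero a * sumVector ∑ n (λ v → ∏ (λ i → w (suc i) (v i))))
    ≡⟨ ∑-cong isSum (λ a → cong (w zero a *_) (sumVector-∏ isSum n (λ i → w (suc i)))) ⟩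
  ∑ (λ a → w zero a * ∏ (λ i → ∑ (w (suc i))))
    ≡⟨ ∑-*ʳ isSum _ (w zero) ⟩
  ∑ (w zero) * ∏ (λ i → ∑ (w (suc i))) ∎
  where open ≡-Reasoning

Matrices : Setoid 0ℓ 0ℓ → ℕ → ℕ → Setoid 0ℓ 0ℓ
Matrices X m k = VecSetoid (VecSetoid X k) m

module _ {X : Setoid 0ℓ 0ℓ} {∑ : Summation (Setoid.Carrier X)} (isSum : IsSummation ∑) (comm : Commute ∑ ∑) where

  open Setoid X using (Carrier) renaming (refl to ≈-refl)

  sumVector-transpose : ∀ k m {f : Vector (Vector Carrier k) m → ℕ} → Extensional (Matrices X m k) f →
    sumVector (sumVector ∑ k) m f ≡ sumVector (sumVector ∑ m) k (λ t → f (transpose t))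
  sumVector-transpose zero m {f} ext = trans (sumEmptyRows m ext) (ext (λ i ()))
    where
    sumEmptyRows : ∀ m {f : Vector (Vector Carrier 0) m → ℕ} → Extensional (Matrices X m 0) f →
      sumVector (sumVector ∑ 0) m f ≡ f (λ _ → []ᵥ)
    sumEmptyRows zero    ext = ext (λ ())
    sumEmptyRows (suc m) {f} ext =
      trans (sumEmptyRows m (extensional-∷ {VecSetoid X 0} {f = f} ext []ᵥ)) (ext λ { zero () ; (suc i) () })
  sumVector-transpose (suc k) m {f} ext = begin
    sumVector (sumVector ∑ (suc k)) m f
      ≡⟨ sumVector-zipWith {VecSetoid X (suc k)} (isSummation-sumVector isSum (suc k)) _∷ᵥ_ isSum
           (isSummation-sumVector isSum k) (commute-sym {∑ = sumVector ∑ k} {∑′ = ∑} (sumVector-commute isSum {∑′ = ∑} comm k))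
           (λ _ → refl) m ext ⟩
    sumVector ∑ m (λ u → sumVector (sumVector ∑ k) m (λ v → f (zipWith _∷ᵥ_ u v)))
      ≡⟨ ∑-cong (isSummation-sumVector isSum m) (λ u →
           sumVector-transpose k m (λ v≋w → ext λ i → λ { zero → ≈-refl ; (suc j) → v≋w i j })) ⟩
    sumVector ∑ m (λ u → sumVector (sumVector ∑ m) k (λ t → f (zipWith _∷ᵥ_ u (transpose t))))
      ≡⟨ ∑-cong (isSummation-sumVector isSum m) (λ u → ∑-cong (isSummation-sumVector (isSummation-sumVector isSum m) k)
           (λ t → ext λ i → λ { zero → ≈-refl ; (suc j) → ≈-refl })) ⟩
    sumVector (sumVector ∑ m) (suc k) (λ t → f (transpose t)) ∎
    where open ≡-Reasoning

-- Boolean vectors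

allᵇ : ∀ {n} → Vector Bool n → Bool
allᵇ = V.foldr _∧_ true

anyᵇ : ∀ {n} → Vector Bool n → Bool
anyᵇ = V.foldr _∨_ false

false≢true : false ≢ true
false≢true ()

_⇒ᵇ_ : Bool → Bool → Bool
a ⇒ᵇ b = not a ∨ b

_≡ᵇ_ : Bool → Bool → Bool
true  ≡ᵇ b = b
false ≡ᵇ b = not b

∧-true⁺ : ∀ {a b} → a ≡ true → b ≡ true → a ∧ b ≡ true
∧-true⁺ refl refl = refl

∧-true⁻ : ∀ {a b} → a ∧ b ≡ true → a ≡ true × b ≡ true
∧-true⁻ {true} b≡true = refl , b≡true

⇒ᵇ-true⁺ : ∀ {a b} → (a ≡ true → b ≡ true) → a ⇒ᵇ b ≡ true
⇒ᵇ-true⁺ {true}  a→b = a→b refl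
⇒ᵇ-true⁺ {false} a→b = refl

⇒ᵇ-true⁻ : ∀ {a b} → a ⇒ᵇ b ≡ true → a ≡ true → b ≡ true
⇒ᵇ-true⁻ {true} b≡true refl = b≡true

≡ᵇ-true⁻ : ∀ {a b} → a ≡ᵇ b ≡ true → a ≡ b
≡ᵇ-true⁻ {true}          b≡true = sym b≡true
≡ᵇ-true⁻ {false} {false} _      = refl

≡ᵇ-refl : ∀ a → a ≡ᵇ a ≡ true
≡ᵇ-refl true  = refl
≡ᵇ-refl false = refl

allᵇ-true⁺ : ∀ {n} {f : Vector Bool n} → (∀ i → f i ≡ true) → allᵇ f ≡ true
allᵇ-true⁺ {zero}  f≡true = refl
allᵇ-true⁺ {suc n} f≡true = ∧-true⁺ (f≡true zero) (allᵇ-true⁺ (λ i → f≡true (suc i)))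

allᵇ-true⁻ : ∀ {n} {f : Vector Bool n} → allᵇ f ≡ true → ∀ i → f i ≡ true
allᵇ-true⁻ {suc n} all≡true zero    = proj₁ (∧-true⁻ all≡true)
allᵇ-true⁻ {suc n} all≡true (suc i) = allᵇ-true⁻ (proj₂ (∧-true⁻ all≡true)) i

anyᵇ-true⁺ : ∀ {n} {f : Vector Bool n} i → f i ≡ true → anyᵇ f ≡ true
anyᵇ-true⁺ {suc n} {f} zero    fi≡true rewrite fi≡true = refl
anyᵇ-true⁺ {suc n} {f} (suc i) fi≡true with f zero
... | true  = refl
... | false = anyᵇ-true⁺ i fi≡true

anyᵇ-true⁻ : ∀ {n} {f : Vector Bool n} → anyᵇ f ≡ true → Σ (Fin n) λ i → f i ≡ true
anyᵇ-true⁻ {suc n} {f} any≡true with f zero in eq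
... | true  = zero , eq
... | false with anyᵇ-true⁻ any≡true
...   | i , fi≡true = suc i , fi≡true

allᵇ-cong : ∀ {n} {f g : Vector Bool n} → (∀ i → f i ≡ g i) → allᵇ f ≡ allᵇ g
allᵇ-cong {zero}  f≗g = refl
allᵇ-cong {suc n} f≗g = cong₂ _∧_ (f≗g zero) (allᵇ-cong (λ i → f≗g (suc i)))

anyᵇ-cong : ∀ {n} {f g : Vector Bool n} → (∀ i → f i ≡ g i) → anyᵇ f ≡ anyᵇ g
anyᵇ-cong {zero}  f≗g = refl
anyᵇ-cong {suc n} f≗g = cong₂ _∨_ (f≗g zero) (anyᵇ-cong (λ i → f≗g (suc i)))

[∧] : ∀ a b → [ a ∧ b ] ≡ [ a ] * [ b ]
[∧] true  b = sym (+-identityʳ _)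
[∧] false b = refl

[allᵇ] : ∀ {n} (f : Vector Bool n) → [ allᵇ f ] ≡ ∏ (λ i → [ f i ])
[allᵇ] {zero}  f = refl
[allᵇ] {suc n} f = trans ([∧] (f zero) _) (cong ([ f zero ] *_) ([allᵇ] (λ i → f (suc i))))

[]-mono : ∀ {a b} → (a ≡ true → b ≡ true) → [ a ] ≤ [ b ]
[]-mono {false} a→b = z≤n
[]-mono {true}  a→b rewrite a→b refl = ≤-refl

_≐ᵇ_ : ∀ {m n} → (Fin m → Fin n → Bool) → (Fin m → Fin n → Bool) → Bool
g ≐ᵇ h = allᵇ λ i → allᵇ λ j → g i j ≡ᵇ h i j

≐ᵇ-true⁺ : ∀ {m n} {g h : Fin m → Fin n → Bool} → (∀ i j → g i j ≡ h i j) → g ≐ᵇ h ≡ true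
≐ᵇ-true⁺ {h = h} g≗h =
  allᵇ-true⁺ λ i → allᵇ-true⁺ λ j → subst (λ b → b ≡ᵇ h i j ≡ true) (sym (g≗h i j)) (≡ᵇ-refl (h i j))

≐ᵇ-true⁻ : ∀ {m n} {g h : Fin m → Fin n → Bool} → g ≐ᵇ h ≡ true → ∀ i j → g i j ≡ h i j
≐ᵇ-true⁻ {g = g} {h} g≐h i j = ≡ᵇ-true⁻ (allᵇ-true⁻ (allᵇ-true⁻ {f = λ i → allᵇ λ j → g i j ≡ᵇ h i j} g≐h i) j)

≐ᵇ-congˡ : ∀ {m n} {g g′ h : Fin m → Fin n → Bool} → (∀ i j → g i j ≡ g′ i j) → g ≐ᵇ h ≡ g′ ≐ᵇ h
≐ᵇ-congˡ {h = h} g≗g′ = allᵇ-cong λ i → allᵇ-cong λ j → cong (_≡ᵇ h i j) (g≗g′ i j)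

_⊆ᵇ_ : ∀ {m} → Vector Bool m → Vector Bool m → Bool
x ⊆ᵇ y = allᵇ (λ i → x i ⇒ᵇ y i)

count : ∀ {n} → Vector Bool n → ℕ
count {zero}  f = 0
count {suc n} f = [ f zero ] + count (λ i → f (suc i))

count-mono : ∀ {n} {f g : Vector Bool n} → (∀ i → f i ≡ true → g i ≡ true) → count f ≤ count g
count-mono {zero}  f⊆g = z≤n
count-mono {suc n} f⊆g = +-mono-≤ ([]-mono (f⊆g zero)) (count-mono (λ i → f⊆g (suc i)))

count-mono-< : ∀ {n} {f g : Vector Bool n} → (∀ i → f i ≡ true → g i ≡ true) →
  ∀ x → f x ≡ false → g x ≡ true → count f < count g
count-mono-< f⊆g zero    fx≡false gx≡true rewrite fx≡false | gx≡true = s≤s (count-mono (λ i → f⊆g (suc i)))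
count-mono-< f⊆g (suc x) fx≡false gx≡true =
  +-mono-≤-< ([]-mono (f⊆g zero)) (count-mono-< (λ i → f⊆g (suc i)) x fx≡false gx≡true)

-- Counting subsets and Boolean matrices

sumBool : Summation Bool
sumBool = sumList (false ∷ true ∷ [])

isSummation-sumBool : IsSummation sumBool
isSummation-sumBool = isSummation-sumList (false ∷ true ∷ [])

sumBool-commute : Commute sumBool sumBool
sumBool-commute = sumList-commute (false ∷ true ∷ []) isSummation-sumBool

sumBool-unique : ∀ (φ : Bool → Bool) → φ false ≡ not (φ true) → sumBool (λ b → [ φ b ]) ≡ 1
sumBool-unique φ φf≡¬φt with φ true
... | true  rewrite φf≡¬φt = refl
... | false rewrite φf≡¬φt = refl

BoolSetoid : Setoid 0ℓ 0ℓ
BoolSetoid = setoid Bool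

sumSubsets : (m : ℕ) → Summation (Vector Bool m)
sumSubsets = sumVector sumBool

isSummation-sumSubsets : ∀ m → IsSummation (sumSubsets m)
isSummation-sumSubsets = isSummation-sumVector isSummation-sumBool

sumSubsets-commute : ∀ m n → Commute (sumSubsets m) (sumSubsets n)
sumSubsets-commute m n = sumVector-commute isSummation-sumBool {∑′ = sumSubsets n}
  (commute-sym {∑ = sumSubsets n} {∑′ = sumBool} (sumVector-commute isSummation-sumBool {∑′ = sumBool} sumBool-commute n)) m

sumMatrices : (m n : ℕ) → Summation (Vector (Vector Bool n) m)
sumMatrices m n = sumVector (sumSubsets n) m

isSummation-sumMatrices : ∀ m n → IsSummation (sumMatrices m n)
isSummation-sumMatrices m n = isSummation-sumVector (isSummation-sumSubsets n) m

sumMatrices-≐ᵇ : ∀ m n (h : Fin m → Fin n → Bool) → sumMatrices m n (λ g → [ g ≐ᵇ h ]) ≡ 1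
sumMatrices-≐ᵇ m n h = begin
  sumMatrices m n (λ g → [ g ≐ᵇ h ])
    ≡⟨ ∑-cong (isSummation-sumMatrices m n) (λ g →
         trans ([allᵇ] (λ i → allᵇ (λ j → g i j ≡ᵇ h i j))) (∏-cong (λ i → [allᵇ] (λ j → g i j ≡ᵇ h i j)))) ⟩
  sumMatrices m n (λ g → ∏ (λ i → ∏ (λ j → [ g i j ≡ᵇ h i j ])))
    ≡⟨ sumVector-∏ (isSummation-sumSubsets n) m (λ i x → ∏ (λ j → [ x j ≡ᵇ h i j ])) ⟩
  ∏ (λ i → sumSubsets n (λ x → ∏ (λ j → [ x j ≡ᵇ h i j ])))
    ≡⟨ ∏-ones (λ i → trans (sumVector-∏ isSummation-sumBool n (λ j b → [ b ≡ᵇ h i j ]))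
                           (∏-ones (λ j → sumBool-unique (_≡ᵇ h i j) refl))) ⟩
  1 ∎
  where open ≡-Reasoning

BoolMatrices : ℕ → ℕ → Setoid 0ℓ 0ℓ
BoolMatrices = Matrices BoolSetoid

sumMatrices-splitRows : ∀ m k n {f : Vector (Vector Bool n) (m + k) → ℕ} → Extensional (BoolMatrices (m + k) n) f →
  sumMatrices (m + k) n f ≡ sumMatrices m n (λ A → sumMatrices k n (λ B → f (A ++ᵥ B)))
sumMatrices-splitRows m k n = sumVector-++ {VecSetoid BoolSetoid n} (isSummation-sumSubsets n) m k

sumMatrices-splitColumns : ∀ n m k {f : Vector (Vector Bool (m + k)) n → ℕ} → Extensional (BoolMatrices n (m + k)) f →
  sumMatrices n (m + k) f ≡ sumMatrices n m (λ A → sumMatrices n k (λ B → f (zipWith _++ᵥ_ A B)))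
sumMatrices-splitColumns n m k = sumVector-zipWith {VecSetoid BoolSetoid (m + k)} (isSummation-sumSubsets (m + k)) _++ᵥ_
  (isSummation-sumSubsets m) (isSummation-sumSubsets k) (sumSubsets-commute m k) (sumVector-++ {BoolSetoid} isSummation-sumBool m k) n

blockMatrix : ∀ {m k} → Vector (Vector Bool m) m → Vector (Vector Bool k) m →
  Vector (Vector Bool m) k → Vector (Vector Bool k) k → Vector (Vector Bool (m + k)) (m + k)
blockMatrix A B C D = zipWith _++ᵥ_ A B ++ᵥ zipWith _++ᵥ_ C D

sumMatrices-blocks : ∀ m k {f : Vector (Vector Bool (m + k)) (m + k) → ℕ} → Extensional (BoolMatrices (m + k) (m + k)) f →
  sumMatrices (m + k) (m + k) f ≡
  sumMatrices m m (λ A → sumMatrices m k (λ B → sumMatrices k m (λ C → sumMatrices k k (λ D → f (blockMatrix A B C D)))))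
sumMatrices-blocks m k {f} ext =
  trans (sumMatrices-splitRows m k (m + k) ext)
  (trans (sumMatrices-splitColumns m m k λ G≋G′ →
            ∑-cong (isSummation-sumMatrices k (m + k)) (λ H → ext (++⁺ _≋_ G≋G′ (λ _ _ → refl))))
  (∑-cong (isSummation-sumMatrices m m) λ A → ∑-cong (isSummation-sumMatrices m k) λ B →
     sumMatrices-splitColumns k m k λ H≋H′ → ext (++⁺ _≋_ (λ _ _ → refl) H≋H′)))
  where open VectorSetoid BoolSetoid using (_≋_)

sumPairs : ∀ m → (Vector Bool m → Vector Bool m → ℕ) → ℕ
sumPairs m F = sumSubsets m (λ x → sumSubsets m (λ y → F x y))

sumSubsets-1 : ∀ m → sumSubsets m (λ _ → 1) ≡ 2 ^ m
sumSubsets-1 zero    = refl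
sumSubsets-1 (suc m) = cong₂ _+_ (sumSubsets-1 m) (cong (_+ 0) (sumSubsets-1 m))

sumPairs-∷ : ∀ m F → sumPairs (suc m) F ≡
  (sumPairs m (λ x y → F (false ∷ᵥ x) (false ∷ᵥ y)) + sumPairs m (λ x y → F (false ∷ᵥ x) (true ∷ᵥ y))) +
  (sumPairs m (λ x y → F (true ∷ᵥ x) (false ∷ᵥ y)) + sumPairs m (λ x y → F (true ∷ᵥ x) (true ∷ᵥ y)))
sumPairs-∷ m F = trans
  (∑-cong isSummation-sumBool {f = λ a → sumSubsets m (λ x → sumBool (λ b → sumSubsets m (λ y → F (a ∷ᵥ x) (b ∷ᵥ y))))}
    (λ a → sumVector-commute isSummation-sumBool {∑′ = sumBool} sumBool-commute m
    (λ x b → sumSubsets m (λ y → F (a ∷ᵥ x) (b ∷ᵥ y)))))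
  (sumBool² (λ a b → sumPairs m (λ x y → F (a ∷ᵥ x) (b ∷ᵥ y))))
  where
  sumBool² : ∀ (S : Bool → Bool → ℕ) →
    sumBool (λ a → sumBool (λ b → S a b)) ≡ (S false false + S false true) + (S true false + S true true)
  sumBool² S = cong₂ _+_ (cong (S false false +_) (+-identityʳ _))
                         (trans (+-identityʳ _) (cong (S true false +_) (+-identityʳ _)))

sumPairs-zero : ∀ m → sumPairs m (λ _ _ → 0) ≡ 0
sumPairs-zero m = trans (∑-cong isSum (λ _ → ∑-zero isSum)) (∑-zero isSum)
  where isSum = isSummation-sumSubsets m

sumSubsets-nonempty : ∀ m → sumSubsets m (λ x → [ anyᵇ x ]) + 1 ≡ 2 ^ m
sumSubsets-nonempty zero    = refl
sumSubsets-nonempty (suc m) = begin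
  (Z + (sumSubsets m (λ _ → 1) + 0)) + 1 ≡⟨ cong (λ s → (Z + (s + 0)) + 1) (sumSubsets-1 m) ⟩
  (Z + (2 ^ m + 0)) + 1                  ≡⟨ rearrange Z (2 ^ m) ⟩
  (Z + 1) + (2 ^ m + 0)                  ≡⟨ cong (_+ (2 ^ m + 0)) (sumSubsets-nonempty m) ⟩
  2 ^ suc m ∎
  where
  open ≡-Reasoning
  Z = sumSubsets m (λ x → [ anyᵇ x ])
  rearrange : ∀ z p → (z + (p + 0)) + 1 ≡ (z + 1) + (p + 0)
  rearrange = solve-∀

sumSubsets-nonempty≡ : ∀ m → sumSubsets m (λ x → [ anyᵇ x ]) ≡ 2 ^ m ∸ 1
sumSubsets-nonempty≡ m = trans (sym (m+n∸n≡m _ 1)) (cong (_∸ 1) (sumSubsets-nonempty m))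

sumPairs-⊆ : ∀ m → sumPairs m (λ x y → [ x ⊆ᵇ y ]) ≡ 3 ^ m
sumPairs-⊆ zero    = refl
sumPairs-⊆ (suc m) = begin
  sumPairs (suc m) (λ x y → [ x ⊆ᵇ y ])    ≡⟨ sumPairs-∷ m (λ x y → [ x ⊆ᵇ y ]) ⟩
  (U + U) + (sumPairs m (λ _ _ → 0) + U)    ≡⟨ cong (λ z → (U + U) + (z + U)) (sumPairs-zero m) ⟩
  (U + U) + (0 + U)                         ≡⟨ solve-∀-3* U ⟩
  3 * U                                     ≡⟨ cong (3 *_) (sumPairs-⊆ m) ⟩
  3 ^ suc m ∎
  where
  open ≡-Reasoning
  U = sumPairs m (λ x y → [ x ⊆ᵇ y ])
  solve-∀-3* : ∀ u → (u + u) + (0 + u) ≡ 3 * u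
  solve-∀-3* = solve-∀

sumPairs-nonempty-⊆ : ∀ m → sumPairs m (λ x y → [ anyᵇ x ∧ x ⊆ᵇ y ]) + 2 ^ m ≡ 3 ^ m
sumPairs-nonempty-⊆ zero    = refl
sumPairs-nonempty-⊆ (suc m) = begin
  sumPairs (suc m) (λ x y → [ anyᵇ x ∧ x ⊆ᵇ y ]) + 2 ^ suc m
    ≡⟨ cong (_+ 2 ^ suc m) (sumPairs-∷ m (λ x y → [ anyᵇ x ∧ x ⊆ᵇ y ])) ⟩
  ((D + D) + (sumPairs m (λ _ _ → 0) + U)) + 2 ^ suc m
    ≡⟨ cong (λ z → ((D + D) + (z + U)) + 2 ^ suc m) (sumPairs-zero m) ⟩
  ((D + D) + (0 + U)) + 2 * 2 ^ m
    ≡⟨ rearrange D U (2 ^ m) ⟩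
  2 * (D + 2 ^ m) + U
    ≡⟨ cong₂ (λ d u → 2 * d + u) (sumPairs-nonempty-⊆ m) (sumPairs-⊆ m) ⟩
  2 * 3 ^ m + 3 ^ m
    ≡⟨ +-comm (2 * 3 ^ m) (3 ^ m) ⟩
  3 ^ suc m ∎
  where
  open ≡-Reasoning
  D = sumPairs m (λ x y → [ anyᵇ x ∧ x ⊆ᵇ y ])
  U = sumPairs m (λ x y → [ x ⊆ᵇ y ])
  rearrange : ∀ d u p → ((d + d) + (0 + u)) + 2 * p ≡ 2 * (d + p) + u
  rearrange = solve-∀

¬→-witness : ∀ {A B : Set} → Dec A → ¬ (A → B) → A × ¬ B
¬→-witness (yes a) ¬a→b = a , λ b → ¬a→b (λ _ → b)
¬→-witness (no ¬a) ¬a→b = ⊥-elim (¬a→b (λ a → ⊥-elim (¬a a)))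

minimal? : ∀ {n} (R : Rel n) x → Dec (Minimal R x)
minimal? R x = all? λ y → (R y x ≟ᵇ true) →-dec (y ≟ᶠ x)

module _ {n} {R : Rel n} (isPO : IsPartialOrder R) where

  private
    R-refl = proj₁ isPO
    R-antisym = proj₁ (proj₂ isPO)
    R-trans = proj₂ (proj₂ isPO)

    height : Fin n → ℕ
    height x = count (λ z → R z x)

  -- Descend to some y < x: fewer elements lie below y than below x, since x itself does not.
  minimal-below : ∀ x → Σ (Fin n) λ y → R y x ≡ true × Minimal R y
  minimal-below x = go x (On.wellFounded height <-wellFounded x)
    where
    go : ∀ x → Acc (_<_ on height) x → Σ (Fin n) λ y → R y x ≡ true × Minimal R y
    go x (acc rs) with minimal? R x
    ... | yes x-min = x , R-refl x , x-min
    ... | no ¬x-min with ¬∀⟶∃¬ n _ (λ y → (R y x ≟ᵇ true) →-dec (y ≟ᶠ x)) ¬x-min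
    ...   | y , ¬y≤x⇒y≡x with ¬→-witness (R y x ≟ᵇ true) ¬y≤x⇒y≡x
    ...     | y≤x , y≢x with go y (rs {y} (count-mono-< (λ z z≤y → R-trans z y x z≤y y≤x) x x≰y (R-refl x)))
      where
      x≰y : R x y ≡ false
      x≰y with R x y in x≤y
      ... | false = refl
      ... | true  = ⊥-elim (y≢x (R-antisym y x y≤x x≤y))
    ...       | z , z≤y , z-min = z , R-trans z y x z≤y y≤x , z-min

comparable-pair : ∀ {k} (P : FinPoset k) → ¬ IsAntichain P → Σ (Fin k) λ a → Σ (Fin k) λ b → rel P a b ≡ true × a ≢ b
comparable-pair {k} P ¬antichain with ¬∀⟶∃¬ k _ (λ a → all? λ b → (rel P a b ≟ᵇ true) →-dec (a ≟ᶠ b)) ¬antichain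
... | a , ¬a-isolated with ¬∀⟶∃¬ k _ (λ b → (rel P a b ≟ᵇ true) →-dec (a ≟ᶠ b)) ¬a-isolated
...   | b , ¬a≤b⇒a≡b with ¬→-witness (rel P a b ≟ᵇ true) ¬a≤b⇒a≡b
...     | a≤b , a≢b = a , b , a≤b , a≢b

-- Extensions of a poset by a set of new minimal elements

data Side (m k : ℕ) : Fin (m + k) → Set where
  inM : (i : Fin m) → Side m k (i ↑ˡ k)
  inK : (j : Fin k) → Side m k (m ↑ʳ j)

side : ∀ m k x → Side m k x
side zero    k x       = inK x
side (suc m) k zero    = inM zero
side (suc m) k (suc x) with side m k x
... | inM i = inM (suc i)
... | inK j = inK j

↑ˡ≢↑ʳ : ∀ {m k} (i : Fin m) (j : Fin k) → i ↑ˡ k ≢ m ↑ʳ j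
↑ˡ≢↑ʳ {suc m} zero    j ()
↑ˡ≢↑ʳ {suc m} (suc i) j eq = ↑ˡ≢↑ʳ i j (suc-injective eq)

module Extensions {k} (P : FinPoset k) (m : ℕ) where

  private
    P-refl = proj₁ (isPO P)
    P-antisym = proj₁ (proj₂ (isPO P))
    P-trans = proj₂ (proj₂ (isPO P))

  upClosedᵇ : Vector Bool k → Bool
  upClosedᵇ x = allᵇ λ a → allᵇ λ b → (rel P a b ∧ x a) ⇒ᵇ x b

  -- G i j records whether the i-th new point lies below the j-th point of P.
  admissibleᵇ : (Fin m → Fin k → Bool) → Bool
  admissibleᵇ G = allᵇ (λ i → upClosedᵇ (G i)) ∧ allᵇ (λ j → anyᵇ (λ i → G i j))

  admissibleᵇ-cong : ∀ {G G′} → (∀ i j → G i j ≡ G′ i j) → admissibleᵇ G ≡ admissibleᵇ G′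
  admissibleᵇ-cong G≗G′ = cong₂ _∧_
    (allᵇ-cong λ i → allᵇ-cong λ a → allᵇ-cong λ b → cong₂ _⇒ᵇ_ (cong (rel P a b ∧_) (G≗G′ i a)) (G≗G′ i b))
    (allᵇ-cong λ j → anyᵇ-cong λ i → G≗G′ i j)

  admissibleᵇ-true⁺ : ∀ {G} → (∀ i {a b} → rel P a b ≡ true → G i a ≡ true → G i b ≡ true) →
    (∀ j → Σ (Fin m) λ i → G i j ≡ true) → admissibleᵇ G ≡ true
  admissibleᵇ-true⁺ upClosed covering =
    ∧-true⁺ (allᵇ-true⁺ {m} λ i → allᵇ-true⁺ {k} λ a → allᵇ-true⁺ {k} λ b → ⇒ᵇ-true⁺ λ a≤b∧i≤a →
               upClosed i (proj₁ (∧-true⁻ a≤b∧i≤a)) (proj₂ (∧-true⁻ a≤b∧i≤a)))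
            (allᵇ-true⁺ {k} λ j → anyᵇ-true⁺ (proj₁ (covering j)) (proj₂ (covering j)))

  admissibleᵇ-upClosed : ∀ {G} → admissibleᵇ G ≡ true → ∀ i {a b} → rel P a b ≡ true → G i a ≡ true → G i b ≡ true
  admissibleᵇ-upClosed {G} adm i {a} {b} a≤b i≤a =
    ⇒ᵇ-true⁻ (allᵇ-true⁻ (allᵇ-true⁻ (allᵇ-true⁻ (proj₁ (∧-true⁻ {allᵇ (λ i → upClosedᵇ (G i))} adm)) i) a) b)
             (∧-true⁺ a≤b i≤a)

  admissibleᵇ-covering : ∀ {G} → admissibleᵇ G ≡ true → ∀ j → Σ (Fin m) λ i → G i j ≡ true
  admissibleᵇ-covering {G} adm j = anyᵇ-true⁻ (allᵇ-true⁻ (proj₂ (∧-true⁻ {allᵇ (λ i → upClosedᵇ (G i))} adm)) j)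

  identityᵇ : Fin m → Fin m → Bool
  identityᵇ i i′ = isYes (i ≟ᶠ i′)

  module _ (Q : Rel (m + k)) where

    MM : Fin m → Fin m → Bool
    MM i i′ = Q (i ↑ˡ k) (i′ ↑ˡ k)
    MK : Fin m → Fin k → Bool
    MK i j = Q (i ↑ˡ k) (m ↑ʳ j)
    KM : Fin k → Fin m → Bool
    KM j i = Q (m ↑ʳ j) (i ↑ˡ k)
    KK : Fin k → Fin k → Bool
    KK j j′ = Q (m ↑ʳ j) (m ↑ʳ j′)

    record BlockForm : Set where
      field
        MM-identity   : ∀ i i′ → MM i i′ ≡ identityᵇ i i′
        KM-false      : ∀ j i → KM j i ≡ false
        KK-P          : ∀ j j′ → KK j j′ ≡ rel P j j′
        MK-admissible : admissibleᵇ MK ≡ true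

    extensionᵇ : Bool
    extensionᵇ = (MM ≐ᵇ identityᵇ) ∧ ((KM ≐ᵇ (λ _ _ → false)) ∧ ((KK ≐ᵇ rel P) ∧ admissibleᵇ MK))

    extensionᵇ-true⁺ : BlockForm → extensionᵇ ≡ true
    extensionᵇ-true⁺ form =
      ∧-true⁺ (≐ᵇ-true⁺ MM-identity) (∧-true⁺ (≐ᵇ-true⁺ KM-false) (∧-true⁺ (≐ᵇ-true⁺ KK-P) MK-admissible))
      where open BlockForm form

    extensionᵇ-true⁻ : extensionᵇ ≡ true → BlockForm
    extensionᵇ-true⁻ ext≡true with ∧-true⁻ {MM ≐ᵇ identityᵇ} ext≡true
    ... | MM≐identity , rest with ∧-true⁻ {KM ≐ᵇ (λ _ _ → false)} rest
    ...   | KM≐false , rest′ with ∧-true⁻ {KK ≐ᵇ rel P} rest′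
    ...     | KK≐P , MK-admissible = record
      { MM-identity = ≐ᵇ-true⁻ MM≐identity ; KM-false = ≐ᵇ-true⁻ KM≐false
      ; KK-P = ≐ᵇ-true⁻ KK≐P ; MK-admissible = MK-admissible }

    extension⇒blockForm : IsExtension m P Q → BlockForm
    extension⇒blockForm (Q-isPO@(Q-refl , _ , Q-trans) , Q↾K≡P , M-minimal , K-notMinimal) = record
      { MM-identity = MM-identity ; KM-false = KM-false ; KK-P = Q↾K≡P
      ; MK-admissible = admissibleᵇ-true⁺ MK-upClosed MK-covering }
      where
      MM-identity : ∀ i i′ → MM i i′ ≡ identityᵇ i i′
      MM-identity i i′ with i ≟ᶠ i′
      ... | yes refl = Q-refl (i ↑ˡ k)
      ... | no i≢i′ with Q (i ↑ˡ k) (i′ ↑ˡ k) in i≤i′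
      ...   | true  = ⊥-elim (i≢i′ (↑ˡ-injective k i i′ (M-minimal i′ (i ↑ˡ k) i≤i′)))
      ...   | false = refl
      KM-false : ∀ j i → KM j i ≡ false
      KM-false j i with Q (m ↑ʳ j) (i ↑ˡ k) in j≤i
      ... | true  = ⊥-elim (↑ˡ≢↑ʳ i j (sym (M-minimal i (m ↑ʳ j) j≤i)))
      ... | false = refl
      MK-upClosed : ∀ i {a b} → rel P a b ≡ true → MK i a ≡ true → MK i b ≡ true
      MK-upClosed i {a} {b} a≤b i≤a = Q-trans _ _ _ i≤a (trans (Q↾K≡P a b) a≤b)
      -- A minimal element below a point of K cannot lie in K, so it is a point of M.
      MK-covering : ∀ j → Σ (Fin m) λ i → MK i j ≡ true
      MK-covering j with minimal-below Q-isPO (m ↑ʳ j)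
      ... | y , y≤j , y-minimal with side m k y
      ...   | inM i  = i , y≤j
      ...   | inK j′ = ⊥-elim (K-notMinimal j′ y-minimal)

    blockForm⇒extension : BlockForm → IsExtension m P Q
    blockForm⇒extension form = (Q-refl , Q-antisym , Q-trans) , KK-P , M-minimal , K-notMinimal
      where
      open BlockForm form
      MM⇒≡ : ∀ i i′ → MM i i′ ≡ true → i ≡ i′
      MM⇒≡ i i′ i≤i′ with i ≟ᶠ i′ | MM-identity i i′
      ... | yes i≡i′ | _    = i≡i′
      ... | no _     | i≰i′ = ⊥-elim (false≢true (trans (sym i≰i′) i≤i′))
      KM-absurd : ∀ {j i} → KM j i ≡ true → ⊥
      KM-absurd {j} {i} j≤i = false≢true (trans (sym (KM-false j i)) j≤i)
      KK⇒P : ∀ j j′ → KK j j′ ≡ true → rel P j j′ ≡ true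
      KK⇒P j j′ j≤j′ = trans (sym (KK-P j j′)) j≤j′

      Q-refl : ∀ x → Q x x ≡ true
      Q-refl x with side m k x
      ... | inM i = trans (MM-identity i i) (cong isYes (≡-≟-identity _≟ᶠ_ refl))
      ... | inK j = trans (KK-P j j) (P-refl j)
      Q-antisym : ∀ x y → Q x y ≡ true → Q y x ≡ true → x ≡ y
      Q-antisym x y x≤y y≤x with side m k x | side m k y
      ... | inM i | inM i′ = cong (_↑ˡ k) (MM⇒≡ i i′ x≤y)
      ... | inM i | inK j  = ⊥-elim (KM-absurd y≤x)
      ... | inK j | inM i  = ⊥-elim (KM-absurd x≤y)
      ... | inK j | inK j′ = cong (m ↑ʳ_) (P-antisym j j′ (KK⇒P j j′ x≤y) (KK⇒P j′ j y≤x))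
      Q-trans : ∀ x y z → Q x y ≡ true → Q y z ≡ true → Q x z ≡ true
      Q-trans x y z x≤y y≤z with side m k x | side m k y | side m k z
      ... | inM i | inM i′ | _ with MM⇒≡ i i′ x≤y
      ...   | refl = y≤z
      Q-trans x y z x≤y y≤z | inM i | inK j  | inM i′ = ⊥-elim (KM-absurd y≤z)
      Q-trans x y z x≤y y≤z | inM i | inK j  | inK j′ = admissibleᵇ-upClosed MK-admissible i (KK⇒P j j′ y≤z) x≤y
      Q-trans x y z x≤y y≤z | inK j | inM i  | _      = ⊥-elim (KM-absurd x≤y)
      Q-trans x y z x≤y y≤z | inK j | inK j′ | inM i  = ⊥-elim (KM-absurd y≤z)
      Q-trans x y z x≤y y≤z | inK j | inK j′ | inK j″ =
        trans (KK-P j j″) (P-trans j j′ j″ (KK⇒P j j′ x≤y) (KK⇒P j′ j″ y≤z))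
      M-minimal : ∀ i → Minimal Q (i ↑ˡ k)
      M-minimal i y y≤i with side m k y
      ... | inM i′ = cong (_↑ˡ k) (MM⇒≡ i′ i y≤i)
      ... | inK j  = ⊥-elim (KM-absurd y≤i)
      K-notMinimal : ∀ j → ¬ Minimal Q (m ↑ʳ j)
      K-notMinimal j j-minimal with admissibleᵇ-covering MK-admissible j
      ... | i , i≤j = ↑ˡ≢↑ʳ i j (j-minimal (i ↑ˡ k) i≤j)

  isExtension?≡extensionᵇ : ∀ Q → isYes (isExtension? m P Q) ≡ extensionᵇ Q
  isExtension?≡extensionᵇ Q with isExtension? m P Q
  ... | yes Q-ext = sym (extensionᵇ-true⁺ Q (extension⇒blockForm Q Q-ext))
  ... | no ¬Q-ext with extensionᵇ Q in ext≡true
  ...   | true  = ⊥-elim (¬Q-ext (blockForm⇒extension Q (extensionᵇ-true⁻ Q ext≡true)))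
  ...   | false = refl

  extensionᵇ-cong : ∀ {Q Q′} → (∀ x y → Q x y ≡ Q′ x y) → extensionᵇ Q ≡ extensionᵇ Q′
  extensionᵇ-cong Q≗Q′ =
    cong₂ _∧_ (≐ᵇ-congˡ (λ i i′ → Q≗Q′ (i ↑ˡ k) (i′ ↑ˡ k)))
    (cong₂ _∧_ (≐ᵇ-congˡ (λ j i → Q≗Q′ (m ↑ʳ j) (i ↑ˡ k)))
    (cong₂ _∧_ (≐ᵇ-congˡ (λ j j′ → Q≗Q′ (m ↑ʳ j) (m ↑ʳ j′)))
               (admissibleᵇ-cong (λ i j → Q≗Q′ (i ↑ˡ k) (m ↑ʳ j)))))

  extensionᵇ-blockMatrix : ∀ A B C D → extensionᵇ (blockMatrix A B C D) ≡
    (A ≐ᵇ identityᵇ) ∧ ((C ≐ᵇ (λ _ _ → false)) ∧ ((D ≐ᵇ rel P) ∧ admissibleᵇ B))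
  extensionᵇ-blockMatrix A B C D =
    cong₂ _∧_ (≐ᵇ-congˡ (λ i i′ → trans (cong-app (lookup-++ˡ AB CD i) _) (lookup-++ˡ (A i) (B i) i′)))
    (cong₂ _∧_ (≐ᵇ-congˡ (λ j i → trans (cong-app (lookup-++ʳ AB CD j) _) (lookup-++ˡ (C j) (D j) i)))
    (cong₂ _∧_ (≐ᵇ-congˡ (λ j j′ → trans (cong-app (lookup-++ʳ AB CD j) _) (lookup-++ʳ (C j) (D j) j′)))
               (admissibleᵇ-cong (λ i j → trans (cong-app (lookup-++ˡ AB CD i) _) (lookup-++ʳ (A i) (B i) j)))))
    where
    AB = zipWith _++ᵥ_ A B
    CD = zipWith _++ᵥ_ C D

  e≡∑extensionᵇ : e m P ≡ sumMatrices (m + k) (m + k) (λ Q → [ extensionᵇ Q ])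
  e≡∑extensionᵇ = begin
    length (filter (isExtension? m P) (allRels (m + k)))
      ≡⟨ length-filter≡sumList (isExtension? m P) (allRels (m + k)) ⟩
    sumList (allRels (m + k)) (λ Q → [ isYes (isExtension? m P Q) ])
      ≡⟨ ∑-cong (isSummation-sumList (allRels (m + k))) (λ Q → cong [_] (isExtension?≡extensionᵇ Q)) ⟩
    sumList (allRels (m + k)) (λ Q → [ extensionᵇ Q ])
      ≡⟨ sumList-allFuns {VecSetoid BoolSetoid (m + k)} rows (m + k) [extensionᵇ]-ext ⟩
    sumVector (sumList rows) (m + k) (λ Q → [ extensionᵇ Q ])
      ≡⟨ sumVector-cong-∑ {VecSetoid BoolSetoid (m + k)} (isSummation-sumList rows) (isSummation-sumSubsets (m + k))
           (sumList-allFuns {BoolSetoid} (false ∷ true ∷ []) (m + k)) (m + k) [extensionᵇ]-ext ⟩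
    sumMatrices (m + k) (m + k) (λ Q → [ extensionᵇ Q ]) ∎
    where
    open ≡-Reasoning
    rows = allFuns (false ∷ true ∷ []) (m + k)
    [extensionᵇ]-ext : Extensional (BoolMatrices (m + k) (m + k)) (λ Q → [ extensionᵇ Q ])
    [extensionᵇ]-ext Q≋Q′ = cong [_] (extensionᵇ-cong Q≋Q′)

  e≡∑admissible : e m P ≡ sumMatrices m k (λ G → [ admissibleᵇ G ])
  e≡∑admissible = begin
    e m P
      ≡⟨ e≡∑extensionᵇ ⟩
    sumMatrices (m + k) (m + k) (λ Q → [ extensionᵇ Q ])
      ≡⟨ sumMatrices-blocks m k (λ Q≋Q′ → cong [_] (extensionᵇ-cong Q≋Q′)) ⟩
    ∑A (λ A → ∑B (λ B → ∑C (λ C → ∑D (λ D → [ extensionᵇ (blockMatrix A B C D) ]))))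
      ≡⟨ ∑-cong isA (λ A → ∑-cong isB (λ B → ∑-cong isC (λ C → ∑-cong isD (λ D →
           trans (cong [_] (extensionᵇ-blockMatrix A B C D)) (factor (isIdentity A) (isZero C) (isP D) (admissibleᵇ B)))))) ⟩
    ∑A (λ A → ∑B (λ B → ∑C (λ C → ∑D (λ D → [ isIdentity A ] * ([ isZero C ] * ([ isP D ] * [ admissibleᵇ B ]))))))
      ≡⟨ ∑-cong isA (λ A → ∑-cong isB (λ B → ∑-cong isC (λ C →
           trans (∑-*ˡ isD [ isIdentity A ] _) (cong ([ isIdentity A ] *_)
             (trans (∑-*ˡ isD [ isZero C ] _) (cong ([ isZero C ] *_) (∑-*ʳ-≡1 isD (sumMatrices-≐ᵇ k k (rel P)) _))))))) ⟩
    ∑A (λ A → ∑B (λ B → ∑C (λ C → [ isIdentity A ] * ([ isZero C ] * [ admissibleᵇ B ]))))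
      ≡⟨ ∑-cong isA (λ A → ∑-cong isB (λ B →
           trans (∑-*ˡ isC [ isIdentity A ] _)
                 (cong ([ isIdentity A ] *_) (∑-*ʳ-≡1 isC (sumMatrices-≐ᵇ k m (λ _ _ → false)) _)))) ⟩
    ∑A (λ A → ∑B (λ B → [ isIdentity A ] * [ admissibleᵇ B ]))
      ≡⟨ ∑-cong isA (λ A → ∑-*ˡ isB [ isIdentity A ] _) ⟩
    ∑A (λ A → [ isIdentity A ] * ∑B (λ B → [ admissibleᵇ B ]))
      ≡⟨ ∑-*ʳ-≡1 isA (sumMatrices-≐ᵇ m m identityᵇ) _ ⟩
    sumMatrices m k (λ G → [ admissibleᵇ G ]) ∎
    where
    open ≡-Reasoning
    ∑A = sumMatrices m m
    ∑B = sumMatrices m k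
    ∑C = sumMatrices k m
    ∑D = sumMatrices k k
    isA = isSummation-sumMatrices m m
    isB = isSummation-sumMatrices m k
    isC = isSummation-sumMatrices k m
    isD = isSummation-sumMatrices k k
    isIdentity = _≐ᵇ identityᵇ
    isZero = _≐ᵇ (λ _ _ → false)
    isP = _≐ᵇ rel P
    factor : ∀ a c d b → [ a ∧ (c ∧ (d ∧ b)) ] ≡ [ a ] * ([ c ] * ([ d ] * [ b ]))
    factor a c d b = trans ([∧] a _) (cong ([ a ] *_) (trans ([∧] c _) (cong ([ c ] *_) ([∧] d b))))

  e≡∑monotone : e m P ≡ sumMatrices k m (λ t → [ admissibleᵇ (transpose t) ])
  e≡∑monotone = trans e≡∑admissible
    (sumVector-transpose {BoolSetoid} isSummation-sumBool sumBool-commute k m {λ G → [ admissibleᵇ G ]}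
       (λ G≋G′ → cong [_] (admissibleᵇ-cong G≋G′)))

admissibleᵇ-antichain : ∀ {k} m (t : Vector (Vector Bool m) k) →
  Extensions.admissibleᵇ (antichain k) m (transpose t) ≡ allᵇ (λ j → anyᵇ (t j))
admissibleᵇ-antichain m t =
  cong (_∧ allᵇ (λ j → anyᵇ (t j))) (allᵇ-true⁺ λ i → allᵇ-true⁺ λ a → allᵇ-true⁺ λ b → ⇒ᵇ-true⁺ (equal-only i a b))
  where
  equal-only : ∀ i a b → isYes (a ≟ᶠ b) ∧ t a i ≡ true → t b i ≡ true
  equal-only i a b a≡b∧i∈ta with a ≟ᶠ b
  ... | yes refl = a≡b∧i∈ta

e-antichain : ∀ m k → e m (antichain k) ≡ (2 ^ m ∸ 1) ^ k
e-antichain m k = begin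
  e m (antichain k)
    ≡⟨ Extensions.e≡∑monotone (antichain k) m ⟩
  sumMatrices k m (λ t → [ Extensions.admissibleᵇ (antichain k) m (transpose t) ])
    ≡⟨ ∑-cong (isSummation-sumMatrices k m) (λ t →
         trans (cong [_] (admissibleᵇ-antichain m t)) ([allᵇ] (λ j → anyᵇ (t j)))) ⟩
  sumMatrices k m (λ t → ∏ (λ j → [ anyᵇ (t j) ]))
    ≡⟨ sumVector-∏ (isSummation-sumSubsets m) k (λ _ x → [ anyᵇ x ]) ⟩
  ∏ {k} (λ _ → sumSubsets m (λ x → [ anyᵇ x ]))
    ≡⟨ ∏-const k _ ⟩
  sumSubsets m (λ x → [ anyᵇ x ]) ^ k
    ≡⟨ cong (_^ k) (sumSubsets-nonempty≡ m) ⟩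
  (2 ^ m ∸ 1) ^ k ∎
  where open ≡-Reasoning

module ComparablePair {k} (P : FinPoset (suc (suc k))) (m : ℕ) {a b} (a≤b : rel P a b ≡ true) (a≢b : a ≢ b) where

  open Extensions P m

  b′ : Fin (suc k)
  b′ = punchOut a≢b

  -- Every map from K to subsets of M arises exactly once as withPair x y t (values x at a, y at b).
  withPair : Vector Bool m → Vector Bool m → Vector (Vector Bool m) k → Vector (Vector Bool m) (suc (suc k))
  withPair x y t = insertAt (insertAt t b′ y) a x

  admissibleᵇ-withPair : ∀ x y t → admissibleᵇ (transpose (withPair x y t)) ≡ true →
    (anyᵇ x ∧ x ⊆ᵇ y) ∧ allᵇ (λ j → anyᵇ (t j)) ≡ true
  admissibleᵇ-withPair x y t adm =
    ∧-true⁺ (∧-true⁺ (subst (λ v → anyᵇ v ≡ true) at-a (nonempty a))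
                     (subst₂ (λ v w → v ⊆ᵇ w ≡ true) at-a at-b Ta⊆Tb))
            (allᵇ-true⁺ {k} λ j → subst (λ v → anyᵇ v ≡ true) (at-rest j) (nonempty (punchIn a (punchIn b′ j))))
    where
    T = withPair x y t
    nonempty : ∀ j → anyᵇ (T j) ≡ true
    nonempty j = let i , i∈Tj = admissibleᵇ-covering {transpose T} adm j in anyᵇ-true⁺ i i∈Tj
    Ta⊆Tb : T a ⊆ᵇ T b ≡ true
    Ta⊆Tb = allᵇ-true⁺ {f = λ i → T a i ⇒ᵇ T b i} λ i → ⇒ᵇ-true⁺ (admissibleᵇ-upClosed {transpose T} adm i a≤b)
    at-a : T a ≡ x
    at-a = insertAt-lookup (insertAt t b′ y) a x
    at-b : T b ≡ y
    at-b = trans (cong T (sym (punchIn-punchOut a≢b)))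
                 (trans (insertAt-punchIn (insertAt t b′ y) a x b′) (insertAt-lookup t b′ y))
    at-rest : ∀ j → T (punchIn a (punchIn b′ j)) ≡ t j
    at-rest j = trans (insertAt-punchIn (insertAt t b′ y) a x (punchIn b′ j)) (insertAt-punchIn t b′ y j)

  sumMatrices-admissible-≤ : sumMatrices (suc (suc k)) m (λ t → [ admissibleᵇ (transpose t) ]) ≤
    sumPairs m (λ x y → [ anyᵇ x ∧ x ⊆ᵇ y ]) * sumSubsets m (λ x → [ anyᵇ x ]) ^ k
  sumMatrices-admissible-≤ = begin
    sumMatrices (suc (suc k)) m q
      ≡⟨ sumVector-insertAt {Subsets} (isSummation-sumSubsets m) (sumSubsets-commute m m) (suc k) a q-ext ⟩
    ∑ (λ x → sumMatrices (suc k) m (λ t → q (insertAt t a x)))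
      ≡⟨ ∑-cong isSum (λ x → sumVector-insertAt {Subsets} (isSummation-sumSubsets m) (sumSubsets-commute m m) k b′
           (λ t≋t′ → q-ext (insertAt-cong {Subsets} t≋t′ a x))) ⟩
    ∑ (λ x → ∑ (λ y → sumMatrices k m (λ t → q (withPair x y t))))
      ≤⟨ ∑-mono-≤ isSum (λ x → ∑-mono-≤ isSum (λ y → ∑-mono-≤ (isSummation-sumMatrices k m) (λ t →
           []-mono-∧ {d = anyᵇ x ∧ x ⊆ᵇ y} {e = λ j → anyᵇ (t j)} (admissibleᵇ-withPair x y t)))) ⟩
    ∑ (λ x → ∑ (λ y → sumMatrices k m (λ t → [ anyᵇ x ∧ x ⊆ᵇ y ] * ∏ (λ j → [ anyᵇ (t j) ]))))
      ≡⟨ ∑-cong isSum (λ x → ∑-cong isSum (λ y →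
           trans (∑-*ˡ (isSummation-sumMatrices k m) [ anyᵇ x ∧ x ⊆ᵇ y ] _)
                 (cong ([ anyᵇ x ∧ x ⊆ᵇ y ] *_) (trans (sumVector-∏ isSum k (λ _ x → [ anyᵇ x ])) (∏-const k _))))) ⟩
    ∑ (λ x → ∑ (λ y → [ anyᵇ x ∧ x ⊆ᵇ y ] * Z ^ k))
      ≡⟨ trans (∑-cong isSum (λ x → ∑-*ʳ isSum (Z ^ k) _)) (∑-*ʳ isSum (Z ^ k) _) ⟩
    sumPairs m (λ x y → [ anyᵇ x ∧ x ⊆ᵇ y ]) * Z ^ k ∎
    where
    open ≤-Reasoning
    Subsets = VecSetoid BoolSetoid m
    ∑ = sumSubsets m
    isSum = isSummation-sumSubsets m
    Z = sumSubsets m (λ x → [ anyᵇ x ])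
    q : Vector (Vector Bool m) (suc (suc k)) → ℕ
    q t = [ admissibleᵇ (transpose t) ]
    q-ext : Extensional (Matrices BoolSetoid (suc (suc k)) m) q
    q-ext t≋t′ = cong [_] (admissibleᵇ-cong (λ i j → t≋t′ j i))
    []-mono-∧ : ∀ {c d e} → (c ≡ true → d ∧ allᵇ e ≡ true) → [ c ] ≤ [ d ] * ∏ (λ j → [ e j ])
    []-mono-∧ {c} {d} {e} c⇒d∧e = subst ([ c ] ≤_) (trans ([∧] d _) (cong ([ d ] *_) ([allᵇ] e))) ([]-mono c⇒d∧e)

-- Arithmetic

^-distribʳ-* : ∀ a b n → (a * b) ^ n ≡ a ^ n * b ^ n
^-distribʳ-* a b zero    = refl
^-distribʳ-* a b (suc n) = trans (cong ((a * b) *_) (^-distribʳ-* a b n)) (interchange′ a b (a ^ n) (b ^ n))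
  where
  interchange′ : ∀ a b x y → (a * b) * (x * y) ≡ (a * x) * (b * y)
  interchange′ = solve-∀

2*6^n≤8^n : ∀ n → 2 * 6 ^ (3 + n) ≤ 8 ^ (3 + n)
2*6^n≤8^n zero    = ≤ᵇ⇒≤ 432 512 _
2*6^n≤8^n (suc n) = begin
  2 * (6 * 6 ^ (3 + n)) ≡⟨ *-comm-middle 2 6 (6 ^ (3 + n)) ⟩
  6 * (2 * 6 ^ (3 + n)) ≤⟨ *-mono-≤ (≤ᵇ⇒≤ 6 8 _) (2*6^n≤8^n n) ⟩
  8 * 8 ^ (3 + n)       ∎
  where
  open ≤-Reasoning
  *-comm-middle : ∀ a b x → a * (b * x) ≡ b * (a * x)
  *-comm-middle = solve-∀

2*6^n<8^n+3^n : ∀ n → 2 * 6 ^ (2 + n) < 8 ^ (2 + n) + 3 ^ (2 + n)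
2*6^n<8^n+3^n zero    = ≤ᵇ⇒≤ 73 73 _
2*6^n<8^n+3^n (suc n) = <-≤-trans (m<m+n (2 * 6 ^ (3 + n)) (m^n>0 3 (3 + n))) (+-monoˡ-≤ (3 ^ (3 + n)) (2*6^n≤8^n n))

<-from-+-≡ : ∀ a b c d → a + b ≡ c + d → d < b → a < c
<-from-+-≡ a b c d a+b≡c+d d<b with a <? c
... | yes a<c = a<c
... | no  a≮c = ⊥-elim (<-irrefl (sym a+b≡c+d) (+-mono-≤-< (≮⇒≥ a≮c) d<b))

-- Writing p = Z + 1 and s = D + p, this is p²(s − p) < s(p − 1)², which rearranges to the hypothesis 2sp < p³ + s.
p²D<sZ² : ∀ D Z → 2 * ((D + (Z + 1)) * (Z + 1)) < (Z + 1) * (Z + 1) * (Z + 1) + (D + (Z + 1)) →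
  (Z + 1) * (Z + 1) * D < (D + (Z + 1)) * (Z * Z)
p²D<sZ² D Z 2sp<p³+s = <-from-+-≡ (p * p * D) (p * p * p) (s * (Z * Z)) (s * (Z + Z + 1)) (expand D Z) s[2Z+1]<p³
  where
  p = Z + 1
  s = D + (Z + 1)
  s[2Z+1]<p³ : s * (Z + Z + 1) < p * p * p
  s[2Z+1]<p³ = +-cancelʳ-< s (s * (Z + Z + 1)) (p * p * p) (subst (_< p * p * p + s) (split D Z) 2sp<p³+s)
    where
    split : ∀ D Z → 2 * ((D + (Z + 1)) * (Z + 1)) ≡ (D + (Z + 1)) * (Z + Z + 1) + (D + (Z + 1))
    split = solve-∀
  expand : ∀ D Z → (Z + 1) * (Z + 1) * D + (Z + 1) * (Z + 1) * (Z + 1) ≡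
                   (D + (Z + 1)) * (Z * Z) + (D + (Z + 1)) * (Z + Z + 1)
  expand = solve-∀

-- Posets with a comparable pair

e-comparablePair : ∀ {k} m (P : FinPoset (suc (suc k))) {a b} → rel P a b ≡ true → a ≢ b → 2 ≤ m →
  4 ^ m * e m P < 3 ^ m * (2 ^ m ∸ 1) ^ (2 + k)
e-comparablePair {k} m@(suc (suc n)) P a≤b a≢b (s≤s (s≤s z≤n)) = begin-strict
  4 ^ m * e m P          ≤⟨ *-monoʳ-≤ (4 ^ m) e≤DZᵏ ⟩
  4 ^ m * (D * Z ^ k)    ≡⟨ cong (_* (D * Z ^ k)) 4^m≡p² ⟩
  p * p * (D * Z ^ k)    ≡⟨ *-assoc (p * p) D (Z ^ k) ⟨
  p * p * D * Z ^ k      <⟨ *-monoˡ-< (Z ^ k) {{Zᵏ≢0}} (p²D<sZ² D Z 2sp<p³+s) ⟩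
  s * (Z * Z) * Z ^ k    ≡⟨ trans (*-assoc s (Z * Z) (Z ^ k)) (cong (s *_) (*-assoc Z Z (Z ^ k))) ⟩
  s * Z ^ (2 + k)        ≡⟨ cong₂ (λ s z → s * z ^ (2 + k)) s≡3^m (sumSubsets-nonempty≡ m) ⟩
  3 ^ m * (2 ^ m ∸ 1) ^ (2 + k) ∎
  where
  open ≤-Reasoning
  D = sumPairs m (λ x y → [ anyᵇ x ∧ x ⊆ᵇ y ])
  Z = sumSubsets m (λ x → [ anyᵇ x ])
  p = Z + 1
  s = D + p
  p≡2^m : p ≡ 2 ^ m
  p≡2^m = sumSubsets-nonempty m
  s≡3^m : s ≡ 3 ^ m
  s≡3^m = trans (cong (D +_) p≡2^m) (sumPairs-nonempty-⊆ m)
  e≤DZᵏ : e m P ≤ D * Z ^ k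
  e≤DZᵏ = subst (_≤ D * Z ^ k) (sym (Extensions.e≡∑monotone P m)) (ComparablePair.sumMatrices-admissible-≤ P m a≤b a≢b)
  4^m≡p² : 4 ^ m ≡ p * p
  4^m≡p² = trans (^-distribʳ-* 2 2 m) (sym (cong₂ _*_ p≡2^m p≡2^m))
  2sp<p³+s : 2 * (s * p) < p * p * p + s
  2sp<p³+s = subst₂ (λ p s → 2 * (s * p) < p * p * p + s) (sym p≡2^m) (sym s≡3^m)
    (subst₂ (λ six eight → 2 * six < eight + 3 ^ m) (^-distribʳ-* 3 2 m)
            (trans (^-distribʳ-* 4 2 m) (cong (_* 2 ^ m) (^-distribʳ-* 2 2 m))) (2*6^n<8^n+3^n n))
  Zᵏ≢0 : NonZero (Z ^ k)
  Zᵏ≢0 = m^n≢0 Z k {{>-nonZero (+-cancelʳ-< 1 0 Z (subst (1 <_) (sym p≡2^m) 1<2^m))}}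
    where
    1<2^m : 1 < 2 ^ m
    1<2^m = ^-monoʳ-< 2 (s≤s (s≤s z≤n)) {0} {m} (s≤s z≤n)

e-non-antichain : ∀ k m (P : FinPoset k) → ¬ IsAntichain P → 2 ≤ m → 4 ^ m * e m P < 3 ^ m * (2 ^ m ∸ 1) ^ k
e-non-antichain k m P ¬antichain 2≤m with comparable-pair P ¬antichain
e-non-antichain (suc zero)    m P _ _   | zero , zero , _ , a≢b = ⊥-elim (a≢b refl)
e-non-antichain (suc (suc k)) m P _ 2≤m | a , b , a≤b , a≢b     = e-comparablePair m P a≤b a≢b 2≤m

theorem6p1 : (k m : ℕ) → (P : FinPoset k) → ¬ IsAntichain P → 2 ≤ m →
    (4 ^ m * e m P < 3 ^ m * (2 ^ m ∸ 1) ^ k) × (e m (antichain k) ≡ (2 ^ m ∸ 1) ^ k)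
theorem6p1 k m P ¬antichain 2≤m = e-non-antichain k m P ¬antichain 2≤m , e-antichain m k
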